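{- Let $\mathbb{M}$ be the set of multiplicative functions, let $W:(\mathbb{N}^{\star})^2\to\mathbb{C}$, and define $(F\,\square\,G)(m)=\sum_{ab=m}F(a)G(b)W(a,b)$ for $F,G\in\mathbb{M}$. Assume that for all $F,G\in\mathbb{M}$ one has $F\,\square\,G\in\mathbb{M}$ and $F\,\square\,G=G\,\square\,F$. Then there exists $E\in\mathbb{M}$ with $F\,\square\,E=E\,\square\,F=F$ for all $F\in\mathbb{M}$ if and only if $W(1,p^{n})=1$ for every prime $p$ and every integer $n\ge0$; in that case $E=\delta_1$.
   Context: $\mathbb{M}$ is the set of functions $F:\mathbb{N}^{\star}\to\mathbb{C}$ with $F(1)=1$ and $F(ab)=F(a)F(b)$ whenever $\gcd(a,b)=1$. $\delta_1(n)=1$ if $n=1$ and $0$ otherwise. The sum $\sum_{ab=m}$ runs over ordered pairs of positive integers with product $m$. -}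

module Defs where

open import Level using (_⊔_)
open import Data.Nat using (ℕ; zero; suc; _≟_; _≥_) renaming (_*_ to _*ℕ_)
open import Data.Nat.Coprimality using (Coprime)
open import Data.Product using (_×_; _,_; proj₁; proj₂)
open import Data.List using (List; map; upTo; cartesianProduct; filter; foldr)
open import Relation.Binary.PropositionalEquality using (_≡_)
open import Algebra.Bundles using (CommutativeRing)

-- Arithmetic functions on ℕ* are modelled as functions ℕ → Carrier;
-- the value at 0 is never used (all statements are guarded by m ≥ 1).
module Arith {c ℓ} (R : CommutativeRing c ℓ) where
  open CommutativeRing R

  Multiplicative : (ℕ → Carrier) → Set ℓ
  Multiplicative F =
    (F 1 ≈ 1#) ×
    (∀ a b → a ≥ 1 → b ≥ 1 → Coprime a b → F (a *ℕ b) ≈ F a * F b)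

  range1 : ℕ → List ℕ
  range1 m = map suc (upTo m)

  pairsWithProduct : ℕ → List (ℕ × ℕ)
  pairsWithProduct m =
    filter (λ ab → proj₁ ab *ℕ proj₂ ab ≟ m) (cartesianProduct (range1 m) (range1 m))

  box : (ℕ → ℕ → Carrier) → (ℕ → Carrier) → (ℕ → Carrier) → ℕ → Carrier
  box W F G m =
    foldr _+_ 0# (map (λ ab → F (proj₁ ab) * G (proj₂ ab) * W (proj₁ ab) (proj₂ ab))
                      (pairsWithProduct m))

  δ₁ : ℕ → Carrier
  δ₁ (suc zero) = 1#
  δ₁ _ = 0#

  IsIdentity : (ℕ → ℕ → Carrier) → (ℕ → Carrier) → Set (c ⊔ ℓ)
  IsIdentity W E =
    ∀ F → Multiplicative F → ∀ m → m ≥ 1 →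
      (box W F E m ≈ F m) × (box W E F m ≈ F m)

{-# OPTIONS --safe #-}
-- Taking δ₁ as one factor gives δ₁ □ F = F · W(1,·) and F □ δ₁ = F · W(·,1).
-- If E is an identity, strong induction shows E = δ₁: once E vanishes strictly between 1
-- and m, the sum for (E □ 1)(m) has only the terms (m,1) and (1,m); E □ δ₁ = δ₁ kills the
-- first and E □ 1 = 1 then forces W(1,m) = 1, after which δ₁ □ E = δ₁ forces E(m) = 0.
-- Conversely δ₁ □ 1 = W(1,·) is multiplicative, hence 1 everywhere once it is 1 on prime
-- powers; commutativity of 1 □ δ₁ gives W(·,1) = W(1,·), so δ₁ is an identity.
module Submission where

open import Defs
open import Level using (Level)
open import Data.Nat using (ℕ; zero; suc; _^_; _≥_; _≤_; _<_; z≤n; s≤s; _≟_)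
  renaming (_*_ to _*ℕ_)
open import Data.Nat.Base using (nonTrivial⇒n>1; >-nonZero)
import Data.Nat.Properties as ℕ
open import Data.Nat.Divisibility using (_∣_; _∣?_; divides; ∣-trans; ∣1⇒≡1; m∣m*n)
open import Data.Nat.Coprimality using (Coprime; coprime-divisor)
open import Data.Nat.Primality using (Prime; prime⇒irreducible; prime⇒nonZero; prime⇒nonTrivial)
open import Data.Nat.Primality.Factorisation using (factorise)
open import Data.Nat.Induction using (<-wellFounded)
open import Induction.WellFounded using (Acc; acc)
open import Data.Product using (Σ; _×_; _,_; proj₁; proj₂; ∃-syntax; ∃₂)
open import Data.Sum using (inj₁; inj₂)
open import Data.List using (List; []; _∷_; map; foldr)
open import Data.List.Membership.Propositional using (_∈_)
open import Data.List.Membership.Propositional.Properties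
  using (∈-map⁺; ∈-map⁻; ∈-upTo⁺; ∈-cartesianProduct⁺; ∈-cartesianProduct⁻; ∈-filter⁺; ∈-filter⁻)
open import Data.List.Relation.Unary.Any using (here; there)
open import Data.List.Relation.Unary.All using (_∷_; lookup)
open import Data.List.Relation.Unary.AllPairs using (_∷_)
open import Data.List.Relation.Unary.Unique.Propositional using (Unique)
import Data.List.Relation.Unary.Unique.Propositional.Properties as Unique
open import Function.Base using (const)
open import Function.Bundles using (_⇔_; mk⇔)
open import Relation.Binary.PropositionalEquality as ≡ using (_≡_; _≢_; refl; cong)
open import Relation.Nullary using (¬_; contradiction; yes; no)
open import Algebra.Bundles using (CommutativeMonoid; CommutativeRing)

module SumMap {c ℓ} (M : CommutativeMonoid c ℓ) where
  open CommutativeMonoid M renaming (refl to ≈-refl; trans to ≈-trans)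
  open import Relation.Binary.Reasoning.Setoid setoid

  private
    variable
      a : Level
      A : Set a
      xs : List A
      h : A → Carrier

  sumMap : (A → Carrier) → List A → Carrier
  sumMap h xs = foldr _∙_ ε (map h xs)

  sumMap-≈ε : (∀ {x} → x ∈ xs → h x ≈ ε) → sumMap h xs ≈ ε
  sumMap-≈ε {xs = []}     h≈ε = ≈-refl
  sumMap-≈ε {xs = x ∷ xs} h≈ε =
    ≈-trans (∙-cong (h≈ε (here refl)) (sumMap-≈ε (λ y∈xs → h≈ε (there y∈xs)))) (identityˡ ε)

  sumMap-≈single : ∀ {k} → Unique xs → k ∈ xs → (∀ {x} → x ∈ xs → x ≢ k → h x ≈ ε) →
                   sumMap h xs ≈ h k
  sumMap-≈single {xs = x ∷ xs} {h} (x∉xs ∷ _) (here refl) h≈ε = begin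
    h x ∙ sumMap h xs ≈⟨ ∙-congˡ (sumMap-≈ε
                          (λ y∈xs → h≈ε (there y∈xs) (λ { refl → lookup x∉xs y∈xs refl }))) ⟩
    h x ∙ ε           ≈⟨ identityʳ (h x) ⟩
    h x               ∎
  sumMap-≈single {xs = x ∷ xs} {h} {k} (x∉xs ∷ xs-unique) (there k∈xs) h≈ε = begin
    h x ∙ sumMap h xs ≈⟨ ∙-cong (h≈ε (here refl) (lookup x∉xs k∈xs))
                                (sumMap-≈single xs-unique k∈xs (λ y∈xs → h≈ε (there y∈xs))) ⟩
    ε ∙ h k           ≈⟨ identityˡ (h k) ⟩
    h k               ∎

  sumMap-≈pair : ∀ {k l} → Unique xs → k ∈ xs → l ∈ xs → k ≢ l →
                 (∀ {x} → x ∈ xs → x ≢ k → x ≢ l → h x ≈ ε) → sumMap h xs ≈ h k ∙ h l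
  sumMap-≈pair (_ ∷ _) (here refl) (here refl) k≢l _ = contradiction refl k≢l
  sumMap-≈pair {xs = x ∷ xs} (x∉xs ∷ xs-unique) (here refl) (there l∈xs) _ h≈ε =
    ∙-congˡ (sumMap-≈single xs-unique l∈xs
      (λ y∈xs → h≈ε (there y∈xs) (λ { refl → lookup x∉xs y∈xs refl })))
  sumMap-≈pair {xs = x ∷ xs} {h} {k} (x∉xs ∷ xs-unique) (there k∈xs) (here refl) _ h≈ε = begin
    h x ∙ sumMap h xs ≈⟨ ∙-congˡ (sumMap-≈single xs-unique k∈xs
                          (λ y∈xs y≢k → h≈ε (there y∈xs) y≢k (λ { refl → lookup x∉xs y∈xs refl }))) ⟩
    h x ∙ h k         ≈⟨ comm (h x) (h k) ⟩
    h k ∙ h x         ∎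
  sumMap-≈pair {xs = x ∷ xs} {h} {k} {l} (x∉xs ∷ xs-unique) (there k∈xs) (there l∈xs) k≢l h≈ε = begin
    h x ∙ sumMap h xs ≈⟨ ∙-cong (h≈ε (here refl) (lookup x∉xs k∈xs) (lookup x∉xs l∈xs))
                                (sumMap-≈pair xs-unique k∈xs l∈xs k≢l (λ y∈xs → h≈ε (there y∈xs))) ⟩
    ε ∙ (h k ∙ h l)   ≈⟨ identityˡ (h k ∙ h l) ⟩
    h k ∙ h l         ∎

prime-divisor : ∀ {m} → 2 ≤ m → ∃[ p ] Prime p × p ∣ m
prime-divisor {m@(suc _)} 2≤m with factorise m
... | record { factors = [] ; isFactorisation = m≡1 } = contradiction m≡1 (ℕ.>⇒≢ 2≤m)
... | record { factors = p ∷ ps ; isFactorisation = m≡p*ps ; factorsPrime = p-prime ∷ _ } =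
  p , p-prime , ≡.subst (p ∣_) (≡.sym m≡p*ps) (m∣m*n _)

module _ {p : ℕ} (p-prime : Prime p) where

  1<p : 1 < p
  1<p = nonTrivial⇒n>1 p {{prime⇒nonTrivial p-prime}}

  p^n≥1 : ∀ n → p ^ n ≥ 1
  p^n≥1 = ℕ.m^n>0 p {{prime⇒nonZero p-prime}}

  ¬∣⇒coprime : ∀ {r} → ¬ p ∣ r → Coprime p r
  ¬∣⇒coprime p∤r (d∣p , d∣r) with prime⇒irreducible p-prime d∣p
  ... | inj₁ d≡1 = d≡1
  ... | inj₂ refl = contradiction d∣r p∤r

  ¬∣⇒coprime-^ : ∀ k {r} → ¬ p ∣ r → Coprime (p ^ k) r
  ¬∣⇒coprime-^ zero    p∤r (d∣1 , _) = ∣1⇒≡1 d∣1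
  ¬∣⇒coprime-^ (suc k) p∤r {d} (d∣p*p^k , d∣r) =
    ¬∣⇒coprime-^ k p∤r (coprime-divisor d⊥p d∣p*p^k , d∣r)
    where
    d⊥p : Coprime d p
    d⊥p (e∣d , e∣p) = ¬∣⇒coprime p∤r (e∣p , ∣-trans e∣d d∣r)

  ∣⇒≡^*¬∣ : ∀ {m} → m ≥ 1 → p ∣ m → ∃₂ λ k r → m ≡ p ^ suc k *ℕ r × ¬ p ∣ r
  ∣⇒≡^*¬∣ = go (<-wellFounded _)
    where
    open ≡.≡-Reasoning
    go : ∀ {m} → Acc _<_ m → m ≥ 1 → p ∣ m → ∃₂ λ k r → m ≡ p ^ suc k *ℕ r × ¬ p ∣ r
    go _ m≥1 (divides zero refl) = contradiction m≥1 λ ()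
    go {m} (acc rec) _ (divides q@(suc _) m≡q*p) with p ∣? q
    ... | no p∤q =
      0 , q , ≡.trans m≡q*p (≡.trans (ℕ.*-comm q p) (cong (_*ℕ q) (≡.sym (ℕ.*-identityʳ p)))) , p∤q
    ... | yes p∣q with go (rec q<m) (s≤s z≤n) p∣q
      where
      q<m : q < m
      q<m = ≡.subst (q <_) (≡.sym m≡q*p) (ℕ.m<m*n q p 1<p)
    ... | k , r , q≡p^k*r , p∤r = suc k , r , m≡ , p∤r
      where
      m≡ : m ≡ p ^ suc (suc k) *ℕ r
      m≡ = begin
        m                     ≡⟨ m≡q*p ⟩
        q *ℕ p                ≡⟨ ℕ.*-comm q p ⟩
        p *ℕ q                ≡⟨ cong (p *ℕ_) q≡p^k*r ⟩
        p *ℕ (p ^ suc k *ℕ r) ≡⟨ ℕ.*-assoc p (p ^ suc k) r ⟨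
        p ^ suc (suc k) *ℕ r  ∎

prime-power-split : ∀ {m} → 2 ≤ m → ∃[ p ] ∃₂ λ k r →
  Prime p × m ≡ p ^ suc k *ℕ r × Coprime (p ^ suc k) r × r ≥ 1 × r < m
prime-power-split {m} 2≤m with prime-divisor 2≤m
... | p , p-prime , p∣m with ∣⇒≡^*¬∣ p-prime (ℕ.<⇒≤ 2≤m) p∣m
... | k , zero , m≡p^k*0 , _ =
  contradiction (≡.trans m≡p^k*0 (ℕ.*-zeroʳ (p ^ suc k))) (ℕ.>⇒≢ (ℕ.<⇒≤ 2≤m))
... | k , r@(suc _) , m≡p^k*r , p∤r =
  p , k , r , p-prime , m≡p^k*r , ¬∣⇒coprime-^ p-prime (suc k) p∤r , s≤s z≤n , r<m
  where
  instance
    _ = prime⇒nonZero p-prime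
    _ = ℕ.m^n≢0 p k
  r<m : r < m
  r<m = ≡.subst (r <_) (≡.trans (ℕ.*-comm r (p ^ suc k)) (≡.sym m≡p^k*r))
          (ℕ.m<m*n r (p ^ suc k) (ℕ.≤-trans (1<p p-prime) (ℕ.m≤m*n p (p ^ k))))

module WeightedConvolution {c ℓ} (R : CommutativeRing c ℓ) where
  open CommutativeRing R renaming (refl to ≈-refl; sym to ≈-sym; trans to ≈-trans)
  open Arith R
  open SumMap +-commutativeMonoid
  open import Relation.Binary.Reasoning.Setoid setoid

  multiplicative-unique : ∀ {F G} → Multiplicative F → Multiplicative G →
    (∀ p k → Prime p → F (p ^ suc k) ≈ G (p ^ suc k)) → ∀ m → m ≥ 1 → F m ≈ G m
  multiplicative-unique {F} {G} (F1≈1 , F-mult) (G1≈1 , G-mult) F≈G m = go (<-wellFounded m)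
    where
    go : ∀ {m} → Acc _<_ m → m ≥ 1 → F m ≈ G m
    go {suc zero} _ _ = ≈-trans F1≈1 (≈-sym G1≈1)
    go {m@(suc (suc _))} (acc rec) _ with prime-power-split (s≤s (s≤s z≤n))
    ... | p , k , r , p-prime , m≡ , coprime , r≥1 , r<m = begin
      F m                 ≡⟨ cong F m≡ ⟩
      F (p ^ suc k *ℕ r)  ≈⟨ F-mult (p ^ suc k) r (p^n≥1 p-prime (suc k)) r≥1 coprime ⟩
      F (p ^ suc k) * F r ≈⟨ *-cong (F≈G p k p-prime) (go (rec r<m) r≥1) ⟩
      G (p ^ suc k) * G r ≈⟨ G-mult (p ^ suc k) r (p^n≥1 p-prime (suc k)) r≥1 coprime ⟨
      G (p ^ suc k *ℕ r)  ≡⟨ cong G m≡ ⟨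
      G m                 ∎

  δ₁≈0 : ∀ {b} → b ≢ 1 → δ₁ b ≈ 0#
  δ₁≈0 {zero}          _   = ≈-refl
  δ₁≈0 {suc zero}      b≢1 = contradiction refl b≢1
  δ₁≈0 {suc (suc _)}   _   = ≈-refl

  δ₁-multiplicative : Multiplicative δ₁
  δ₁-multiplicative = ≈-refl , δ₁-*
    where
    δ₁-* : ∀ a b → a ≥ 1 → b ≥ 1 → Coprime a b → δ₁ (a *ℕ b) ≈ δ₁ a * δ₁ b
    δ₁-* (suc zero)    b _ _ _ = begin
      δ₁ (1 *ℕ b) ≡⟨ cong δ₁ (ℕ.*-identityˡ b) ⟩
      δ₁ b        ≈⟨ *-identityˡ (δ₁ b) ⟨
      1# * δ₁ b   ∎
    δ₁-* a@(suc (suc _)) b _ _ _ = begin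
      δ₁ (a *ℕ b) ≈⟨ δ₁≈0 (λ a*b≡1 → contradiction (ℕ.m*n≡1⇒m≡1 a b a*b≡1) λ ()) ⟩
      0#          ≈⟨ zeroˡ (δ₁ b) ⟨
      0# * δ₁ b   ∎

  const1#-multiplicative : Multiplicative (const 1#)
  const1#-multiplicative = ≈-refl , λ _ _ _ _ _ → ≈-sym (*-identityʳ 1#)

  ∈-pairsWithProduct⁺ : ∀ {a b m} → a ≥ 1 → b ≥ 1 → a *ℕ b ≡ m → (a , b) ∈ pairsWithProduct m
  ∈-pairsWithProduct⁺ {a@(suc _)} {b@(suc _)} {m} a≥1 b≥1 a*b≡m =
    ∈-filter⁺ (λ (x , y) → x *ℕ y ≟ m)
      (∈-cartesianProduct⁺ (∈-range1⁺ a≥1 (≡.subst (a ≤_) a*b≡m (ℕ.m≤m*n a b)))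
                           (∈-range1⁺ b≥1 (≡.subst (b ≤_) a*b≡m (ℕ.m≤n*m b a))))
      a*b≡m
    where
    ∈-range1⁺ : ∀ {x m} → x ≥ 1 → x ≤ m → x ∈ range1 m
    ∈-range1⁺ {suc x} _ x<m = ∈-map⁺ suc (∈-upTo⁺ x<m)

  ∈-pairsWithProduct⁻ : ∀ {a b m} → (a , b) ∈ pairsWithProduct m → a ≥ 1 × b ≥ 1 × a *ℕ b ≡ m
  ∈-pairsWithProduct⁻ {m = m} ab∈ with ∈-filter⁻ (λ (x , y) → x *ℕ y ≟ m) ab∈
  ... | ab∈range² , a*b≡m with ∈-cartesianProduct⁻ (range1 m) (range1 m) ab∈range²
  ... | a∈range , b∈range = ∈-range1⁻ a∈range , ∈-range1⁻ b∈range , a*b≡m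
    where
    ∈-range1⁻ : ∀ {x m} → x ∈ range1 m → x ≥ 1
    ∈-range1⁻ x∈ with ∈-map⁻ suc x∈
    ... | _ , _ , refl = s≤s z≤n

  pairsWithProduct-unique : ∀ m → Unique (pairsWithProduct m)
  pairsWithProduct-unique m = Unique.filter⁺ (λ (x , y) → x *ℕ y ≟ m)
    (Unique.cartesianProduct⁺ range1-unique range1-unique)
    where
    range1-unique : Unique (range1 m)
    range1-unique = Unique.map⁺ ℕ.suc-injective (Unique.upTo⁺ m)

  term-zeroˡ : ∀ {x y w} → x ≈ 0# → x * y * w ≈ 0#
  term-zeroˡ {x} {y} {w} x≈0 = ≈-trans (*-congʳ (≈-trans (*-congʳ x≈0) (zeroˡ y))) (zeroˡ w)

  term-zeroʳ : ∀ {x y w} → y ≈ 0# → x * y * w ≈ 0#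
  term-zeroʳ {x} {y} {w} y≈0 = ≈-trans (*-congʳ (≈-trans (*-congˡ y≈0) (zeroʳ x))) (zeroˡ w)

  module _ (W : ℕ → ℕ → Carrier) where

    boxTerm : (ℕ → Carrier) → (ℕ → Carrier) → ℕ × ℕ → Carrier
    boxTerm F G (a , b) = F a * G b * W a b

    box-δ₁ʳ : ∀ F {m} → m ≥ 1 → box W F δ₁ m ≈ F m * W m 1
    box-δ₁ʳ F {m} m≥1 = ≈-trans
      (sumMap-≈single (pairsWithProduct-unique m)
        (∈-pairsWithProduct⁺ m≥1 (s≤s z≤n) (ℕ.*-identityʳ m)) vanish)
      (*-congʳ (*-identityʳ (F m)))
      where
      vanish : ∀ {ab} → ab ∈ pairsWithProduct m → ab ≢ (m , 1) → boxTerm F δ₁ ab ≈ 0#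
      vanish {a , b} ab∈ ab≢m,1 with ∈-pairsWithProduct⁻ {m = m} ab∈
      ... | _ , _ , a*b≡m = term-zeroʳ (δ₁≈0 {b} λ { refl →
        ab≢m,1 (cong (_, 1) (≡.trans (≡.sym (ℕ.*-identityʳ a)) a*b≡m)) })

    box-δ₁ˡ : ∀ F {m} → m ≥ 1 → box W δ₁ F m ≈ F m * W 1 m
    box-δ₁ˡ F {m} m≥1 = ≈-trans
      (sumMap-≈single (pairsWithProduct-unique m)
        (∈-pairsWithProduct⁺ (s≤s z≤n) m≥1 (ℕ.*-identityˡ m)) vanish)
      (*-congʳ (*-identityˡ (F m)))
      where
      vanish : ∀ {ab} → ab ∈ pairsWithProduct m → ab ≢ (1 , m) → boxTerm δ₁ F ab ≈ 0#
      vanish {a , b} ab∈ ab≢1,m with ∈-pairsWithProduct⁻ {m = m} ab∈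
      ... | _ , _ , a*b≡m = term-zeroˡ (δ₁≈0 {a} λ { refl →
        ab≢1,m (cong (1 ,_) (≡.trans (≡.sym (ℕ.*-identityˡ b)) a*b≡m)) })

    box-trivialPairs : ∀ F G {m} → 2 ≤ m → (∀ {a} → 1 < a → a < m → F a ≈ 0#) →
                       box W F G m ≈ F m * G 1 * W m 1 + F 1 * G m * W 1 m
    box-trivialPairs F G {m} 2≤m F≈0 = sumMap-≈pair (pairsWithProduct-unique m)
      (∈-pairsWithProduct⁺ m≥1 (s≤s z≤n) (ℕ.*-identityʳ m))
      (∈-pairsWithProduct⁺ (s≤s z≤n) m≥1 (ℕ.*-identityˡ m))
      (λ m,1≡1,m → ℕ.>⇒≢ 2≤m (cong proj₁ m,1≡1,m))
      vanish
      where
      m≥1 : m ≥ 1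
      m≥1 = ℕ.<⇒≤ 2≤m
      instance
        _ = >-nonZero m≥1
      vanish : ∀ {ab} → ab ∈ pairsWithProduct m → ab ≢ (m , 1) → ab ≢ (1 , m) → boxTerm F G ab ≈ 0#
      vanish {a , b} ab∈ ab≢m,1 ab≢1,m with ∈-pairsWithProduct⁻ {m = m} ab∈
      ... | a≥1 , b≥1 , a*b≡m = term-zeroˡ (F≈0 1<a a<m)
        where
        instance
          _ = >-nonZero b≥1
        1<a : 1 < a
        1<a = ℕ.≤∧≢⇒< a≥1 λ { refl →
          ab≢1,m (cong (1 ,_) (≡.trans (≡.sym (ℕ.*-identityˡ b)) a*b≡m)) }
        a<m : a < m
        a<m = ℕ.≤∧≢⇒< (≡.subst (a ≤_) a*b≡m (ℕ.m≤m*n a b))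
                λ { refl → ab≢m,1 (cong (a ,_)
                      (ℕ.*-cancelˡ-≡ b 1 a (≡.trans a*b≡m (≡.sym (ℕ.*-identityʳ a))))) }

    module _ {E} (E-multiplicative : Multiplicative E) (E-identity : IsIdentity W E) where

      identity-step : ∀ {m} → 2 ≤ m → (∀ {a} → a ≥ 1 → a < m → E a ≈ δ₁ a) →
                      W 1 m ≈ 1# × E m ≈ 0#
      identity-step {m} 2≤m E≈δ₁ = W1m≈1 , Em≈0
        where
        m≥1 : m ≥ 1
        m≥1 = ℕ.<⇒≤ 2≤m
        δ₁m≈0 : δ₁ m ≈ 0#
        δ₁m≈0 = δ₁≈0 (ℕ.>⇒≢ 2≤m)
        E≈0 : ∀ {a} → 1 < a → a < m → E a ≈ 0#
        E≈0 1<a a<m = ≈-trans (E≈δ₁ (ℕ.<⇒≤ 1<a) a<m) (δ₁≈0 (ℕ.>⇒≢ 1<a))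
        EmWm1≈0 : E m * W m 1 ≈ 0#
        EmWm1≈0 = begin
          E m * W m 1  ≈⟨ box-δ₁ʳ E m≥1 ⟨
          box W E δ₁ m ≈⟨ proj₂ (E-identity δ₁ δ₁-multiplicative m m≥1) ⟩
          δ₁ m         ≈⟨ δ₁m≈0 ⟩
          0#           ∎
        Em1Wm1≈0 : E m * 1# * W m 1 ≈ 0#
        Em1Wm1≈0 = ≈-trans (*-congʳ (*-identityʳ (E m))) EmWm1≈0
        E11W1m≈W1m : E 1 * 1# * W 1 m ≈ W 1 m
        E11W1m≈W1m = ≈-trans (*-congʳ (≈-trans (*-identityʳ (E 1)) (proj₁ E-multiplicative)))
                             (*-identityˡ (W 1 m))
        W1m≈1 : W 1 m ≈ 1#
        W1m≈1 = begin
          W 1 m                                ≈⟨ +-identityˡ (W 1 m) ⟨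
          0# + W 1 m                           ≈⟨ +-cong Em1Wm1≈0 E11W1m≈W1m ⟨
          E m * 1# * W m 1 + E 1 * 1# * W 1 m  ≈⟨ box-trivialPairs E (const 1#) 2≤m E≈0 ⟨
          box W E (const 1#) m                 ≈⟨ proj₂ (E-identity (const 1#) const1#-multiplicative m m≥1) ⟩
          1#                                   ∎
        Em≈0 : E m ≈ 0#
        Em≈0 = begin
          E m          ≈⟨ *-identityʳ (E m) ⟨
          E m * 1#     ≈⟨ *-congˡ W1m≈1 ⟨
          E m * W 1 m  ≈⟨ box-δ₁ˡ E m≥1 ⟨
          box W δ₁ E m ≈⟨ proj₁ (E-identity δ₁ δ₁-multiplicative m m≥1) ⟩
          δ₁ m         ≈⟨ δ₁m≈0 ⟩
          0#           ∎

      identity≈δ₁ : ∀ m → m ≥ 1 → E m ≈ δ₁ m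
      identity≈δ₁ m = go (<-wellFounded m)
        where
        go : ∀ {m} → Acc _<_ m → m ≥ 1 → E m ≈ δ₁ m
        go {suc zero}        _         _ = proj₁ E-multiplicative
        go {m@(suc (suc _))} (acc rec) _ =
          proj₂ (identity-step (s≤s (s≤s z≤n)) λ a≥1 a<m → go (rec a<m) a≥1)

      identity⇒W1≈1 : ∀ m → m ≥ 1 → W 1 m ≈ 1#
      identity⇒W1≈1 (suc zero) 1≥1 = begin
        W 1 1        ≈⟨ *-identityˡ (W 1 1) ⟨
        1# * W 1 1   ≈⟨ *-congʳ (proj₁ E-multiplicative) ⟨
        E 1 * W 1 1  ≈⟨ box-δ₁ˡ E 1≥1 ⟨
        box W δ₁ E 1 ≈⟨ proj₁ (E-identity δ₁ δ₁-multiplicative 1 1≥1) ⟩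
        1#           ∎
      identity⇒W1≈1 (suc (suc _)) _ =
        proj₁ (identity-step (s≤s (s≤s z≤n)) λ a≥1 _ → identity≈δ₁ _ a≥1)

    W1≈1-fromPrimePowers : Multiplicative (box W δ₁ (const 1#)) →
      (∀ p n → Prime p → W 1 (p ^ n) ≈ 1#) → ∀ m → m ≥ 1 → W 1 m ≈ 1#
    W1≈1-fromPrimePowers δ₁□1-multiplicative W1p^n≈1 m m≥1 = begin
      W 1 m                 ≈⟨ box-δ₁ˡ≈W1 m≥1 ⟨
      box W δ₁ (const 1#) m ≈⟨ multiplicative-unique δ₁□1-multiplicative const1#-multiplicative
                                 δ₁□1≈1-atPrimePowers m m≥1 ⟩
      1#                    ∎
      where
      box-δ₁ˡ≈W1 : ∀ {m} → m ≥ 1 → box W δ₁ (const 1#) m ≈ W 1 m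
      box-δ₁ˡ≈W1 m≥1 = ≈-trans (box-δ₁ˡ (const 1#) m≥1) (*-identityˡ _)
      δ₁□1≈1-atPrimePowers : ∀ p k → Prime p → box W δ₁ (const 1#) (p ^ suc k) ≈ 1#
      δ₁□1≈1-atPrimePowers p k p-prime =
        ≈-trans (box-δ₁ˡ≈W1 (p^n≥1 p-prime (suc k))) (W1p^n≈1 p (suc k) p-prime)

    Wm1≈W1m : ∀ {m} → m ≥ 1 → box W (const 1#) δ₁ m ≈ box W δ₁ (const 1#) m → W m 1 ≈ W 1 m
    Wm1≈W1m {m} m≥1 □-comm = begin
      W m 1                 ≈⟨ *-identityˡ (W m 1) ⟨
      1# * W m 1            ≈⟨ box-δ₁ʳ (const 1#) m≥1 ⟨
      box W (const 1#) δ₁ m ≈⟨ □-comm ⟩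
      box W δ₁ (const 1#) m ≈⟨ box-δ₁ˡ (const 1#) m≥1 ⟩
      1# * W 1 m            ≈⟨ *-identityˡ (W 1 m) ⟩
      W 1 m                 ∎

    δ₁-isIdentity : (∀ m → m ≥ 1 → W 1 m ≈ 1#) → (∀ m → m ≥ 1 → W m 1 ≈ 1#) → IsIdentity W δ₁
    δ₁-isIdentity W1≈1 Wm1≈1 F _ m m≥1 =
      ≈-trans (box-δ₁ʳ F m≥1) (≈-trans (*-congˡ (Wm1≈1 m m≥1)) (*-identityʳ (F m))) ,
      ≈-trans (box-δ₁ˡ F m≥1) (≈-trans (*-congˡ (W1≈1 m m≥1)) (*-identityʳ (F m)))

mainTheorem8 : ∀ {c ℓ} (R : CommutativeRing c ℓ) →
    let open CommutativeRing R in
    let open Arith R in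
    (W : ℕ → ℕ → Carrier) →
    (∀ F G → Multiplicative F → Multiplicative G → Multiplicative (box W F G)) →
    (∀ F G → Multiplicative F → Multiplicative G → ∀ m → m ≥ 1 → box W F G m ≈ box W G F m) →
    ((Σ (ℕ → Carrier) λ E → Multiplicative E × IsIdentity W E)
       ⇔ (∀ p n → Prime p → W 1 (p ^ n) ≈ 1#))
    × (∀ E → Multiplicative E → IsIdentity W E → ∀ m → m ≥ 1 → E m ≈ δ₁ m)
mainTheorem8 R W □-multiplicative □-comm =
  mk⇔ (λ (E , E-multiplicative , E-identity) p n p-prime →
         identity⇒W1≈1 W E-multiplicative E-identity (p ^ n) (p^n≥1 p-prime n))
      (λ W1p^n≈1 → δ₁ , δ₁-multiplicative , δ₁-isIdentity W (W1≈1 W1p^n≈1) (Wm1≈1 W1p^n≈1)) ,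
  λ _ E-multiplicative E-identity → identity≈δ₁ W E-multiplicative E-identity
  where
  open CommutativeRing R
  open Arith R
  open WeightedConvolution R

  W1≈1 : (∀ p n → Prime p → W 1 (p ^ n) ≈ 1#) → ∀ m → m ≥ 1 → W 1 m ≈ 1#
  W1≈1 = W1≈1-fromPrimePowers W
    (□-multiplicative δ₁ (const 1#) δ₁-multiplicative const1#-multiplicative)

  Wm1≈1 : (∀ p n → Prime p → W 1 (p ^ n) ≈ 1#) → ∀ m → m ≥ 1 → W m 1 ≈ 1#
  Wm1≈1 W1p^n≈1 m m≥1 = trans
    (Wm1≈W1m W m≥1 (□-comm (const 1#) δ₁ const1#-multiplicative δ₁-multiplicative m m≥1))
    (W1≈1 W1p^n≈1 m m≥1)
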